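{- Let $x\in{}^\omega(\omega-\{0\})$ be strictly increasing, let $T$ be an $x$-squeezed tree and let $n\in\omega$. Then $T\cap{}^n\omega$ is finite.
   Context: Let $x$ be strictly increasing and $n\in\omega$. A triple $(j,k,m)$ is an $x$-bound system above $n$ iff $k\in\omega$, $j,m:\{0,\dots,k\}\to\omega$, $j(0)>x(n+m(0)+1)$, and $j(l+1)>x(j(l)+m(l+1)+1)$ for all $l<k$. A tree $T\subseteq{}^{<\omega}\omega$ (closed under initial segments) is $(j,k,m,\eta)$-squeezed iff $\mathrm{dom}(\eta)=\{(l,t):l\le k,\ t\le m(l)\}$, $\eta(l,t)\in{}^{j(l)}\omega$, and every $\nu\in T$ is comparable with some $\eta(l,t)$. $T$ is $x$-squeezed iff for every $n$ there are an $x$-bound system $(j,k,m)$ above $n$ and $\eta$ with $T$ $(j,k,m,\eta)$-squeezed. -}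

module Defs where

open import Data.Nat using (ℕ; suc; _+_; _<_)
open import Data.Fin using (Fin; inject₁; zero) renaming (suc to fsuc)
open import Data.List using (List; length)
open import Data.List.Membership.Propositional using (_∈_)
open import Data.List.Relation.Binary.Prefix.Heterogeneous using (Prefix)
open import Data.Product using (Σ; ∃; _×_)
open import Data.Sum using (_⊎_)
open import Relation.Binary.PropositionalEquality using (_≡_)
open import Relation.Nullary using (¬_)

Seq : Set
Seq = List ℕ

_⊑_ : Seq → Seq → Set
μ ⊑ ν = Prefix _≡_ μ ν

Comparable : Seq → Seq → Set
Comparable μ ν = μ ⊑ ν ⊎ ν ⊑ μ

StrictlyIncreasing : (ℕ → ℕ) → Set
StrictlyIncreasing x = ∀ a b → a < b → x a < x b

IsTree : (Seq → Set) → Set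
IsTree T = ∀ μ ν → μ ⊑ ν → T ν → T μ

IsBoundSystem : (x : ℕ → ℕ) (n k : ℕ) (j m : Fin (suc k) → ℕ) → Set
IsBoundSystem x n k j m =
  (x (n + m zero + 1) < j zero) ×
  (∀ (l : Fin k) → x (j (inject₁ l) + m (fsuc l) + 1) < j (fsuc l))

Eta : (k : ℕ) (m : Fin (suc k) → ℕ) → Set
Eta k m = (l : Fin (suc k)) → Fin (suc (m l)) → Seq

Squeezed : (T : Seq → Set) (k : ℕ) (j m : Fin (suc k) → ℕ) (η : Eta k m) → Set
Squeezed T k j m η =
  (∀ l t → length (η l t) ≡ j l) ×
  (∀ ν → T ν → Σ (Fin (suc k)) λ l → Σ (Fin (suc (m l))) λ t → Comparable ν (η l t))

XSqueezed : (x : ℕ → ℕ) (T : Seq → Set) → Set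
XSqueezed x T =
  ∀ n → Σ ℕ λ k → Σ (Fin (suc k) → ℕ) λ j → Σ (Fin (suc k) → ℕ) λ m →
    IsBoundSystem x n k j m × Σ (Eta k m) λ η → Squeezed T k j m η

LevelFinite : (T : Seq → Set) (n : ℕ) → Set
LevelFinite T n = Σ (List Seq) λ L → ∀ ν → T ν → length ν ≡ n → ν ∈ L

module Submission where

-- Fix n and take the x-bound system (j,k,m) above n and the
-- sequences η(l,t) squeezing T that x-squeezedness provides.  Since x is
-- strictly increasing we have a ≤ x a, so every level j(l) of the bound
-- system exceeds n: j(0) > x(n + m(0) + 1) > n, and the levels increase.
-- A node ν ∈ T of length n is comparable with some η(l,t) of length j(l) > n,
-- so ν must be an initial segment of η(l,t), i.e. ν = take n (η(l,t)).
-- Hence T ∩ ω^n is contained in the finite list of all  take n (η(l,t)).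

open import Defs
open import Data.Nat using (ℕ; zero; suc; _+_; _<_; _≤_; z≤n; s≤s)
open import Data.Nat.Properties
  using (≤-refl; ≤-trans; <-trans; <⇒≤; <-≤-trans; ≤-<-trans; <⇒≱; m≤m+n; m<m+n)
open import Data.Fin using (Fin; inject₁) renaming (zero to fzero; suc to fsuc)
open import Data.List using (List; _∷_; length; take; map; concatMap; allFin)
open import Data.List.Membership.Propositional using (_∈_)
open import Data.List.Membership.Propositional.Properties
  using (∈-map⁺; ∈-concatMap⁺; ∈-allFin)
open import Data.List.Relation.Binary.Prefix.Heterogeneous using ([]; _∷_)
open import Data.List.Relation.Binary.Prefix.Heterogeneous.Properties
  using (length-mono)
import Data.List.Relation.Unary.Any as Any
open import Data.Product using (Σ; _×_; _,_)
open import Data.Sum using (inj₁; inj₂)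
open import Data.Empty using (⊥-elim)
open import Function using (_∘_)
open import Relation.Binary.PropositionalEquality
  using (_≢_; _≡_; refl; sym; cong; subst)

≤-strictlyIncreasing : (x : ℕ → ℕ) → StrictlyIncreasing x → ∀ a → a ≤ x a
≤-strictlyIncreasing x inc zero    = z≤n
≤-strictlyIncreasing x inc (suc a) =
  ≤-trans (s≤s (≤-strictlyIncreasing x inc a)) (inc a (suc a) ≤-refl)

-- In particular every argument a + b + 1 lifts a strictly above a; this is
-- the shape of both clauses of a bound system.
<-strictlyIncreasing-+1 : (x : ℕ → ℕ) → StrictlyIncreasing x →
  ∀ a b → a < x (a + b + 1)
<-strictlyIncreasing-+1 x inc a b =
  <-≤-trans (≤-<-trans (m≤m+n a b) (m<m+n (a + b) (s≤s z≤n)))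
            (≤-strictlyIncreasing x inc (a + b + 1))

first≤chain : ∀ {k} (j : Fin (suc k) → ℕ) →
  (∀ l → j (inject₁ l) < j (fsuc l)) → ∀ l → j fzero ≤ j l
first≤chain         j step fzero    = ≤-refl
first≤chain {suc k} j step (fsuc l) =
  ≤-trans (<⇒≤ (step fzero)) (first≤chain (j ∘ fsuc) (step ∘ fsuc) l)

boundSystem-above : (x : ℕ → ℕ) → StrictlyIncreasing x →
  ∀ n k (j m : Fin (suc k) → ℕ) → IsBoundSystem x n k j m →
  ∀ l → n < j l
boundSystem-above x inc n k j m (first , next) l =
  <-≤-trans n<j0 (first≤chain j step l)
  where
  n<j0 : n < j fzero
  n<j0 = <-trans (<-strictlyIncreasing-+1 x inc n (m fzero)) first

  step : ∀ l → j (inject₁ l) < j (fsuc l)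
  step l = <-trans
    (<-strictlyIncreasing-+1 x inc (j (inject₁ l)) (m (fsuc l))) (next l)

⊑⇒≡take : ∀ {μ ν} → μ ⊑ ν → μ ≡ take (length μ) ν
⊑⇒≡take []           = refl
⊑⇒≡take (refl ∷ μ⊑ν) = cong (_ ∷_) (⊑⇒≡take μ⊑ν)

levelFinite-byPrefixes : (T : Seq → Set) (n : ℕ) (S : List Seq) →
  (∀ ν → T ν → length ν ≡ n → Σ Seq λ σ → σ ∈ S × ν ⊑ σ) →
  LevelFinite T n
levelFinite-byPrefixes T n S covered = map (take n) S , member
  where
  member : ∀ ν → T ν → length ν ≡ n → ν ∈ map (take n) S
  member ν Tν refl with covered ν Tν refl
  ... | σ , σ∈S , ν⊑σ = subst (_∈ map (take n) S) (sym (⊑⇒≡take ν⊑σ))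
                              (∈-map⁺ (take n) σ∈S)

etaList : (k : ℕ) (m : Fin (suc k) → ℕ) → Eta k m → List Seq
etaList k m η = concatMap (λ l → map (η l) (allFin (suc (m l)))) (allFin (suc k))

∈-etaList : ∀ k m (η : Eta k m) l t → η l t ∈ etaList k m η
∈-etaList k m η l t =
  ∈-concatMap⁺ (λ l → map (η l) (allFin (suc (m l))))
    (Any.map (λ { refl → ∈-map⁺ (η l) (∈-allFin t) }) (∈-allFin l))

-- If T is (j,k,m,η)-squeezed and every level j(l) exceeds n, then each node
-- of T of length n is an initial segment of some η(l,t): the other direction
-- of comparability would force j(l) = length η(l,t) ≤ n.
squeezed-coversLevel : (T : Seq → Set) (n k : ℕ) (j m : Fin (suc k) → ℕ)
  (η : Eta k m) → Squeezed T k j m η → (∀ l → n < j l) →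
  ∀ ν → T ν → length ν ≡ n → Σ Seq λ σ → σ ∈ etaList k m η × ν ⊑ σ
squeezed-coversLevel T n k j m η (lengthη , comparable) n<j ν Tν refl
  with comparable ν Tν
... | l , t , inj₁ ν⊑η = η l t , ∈-etaList k m η l t , ν⊑η
... | l , t , inj₂ η⊑ν =
  ⊥-elim (<⇒≱ (n<j l) (subst (_≤ length ν) (lengthη l t) (length-mono η⊑ν)))

lemma7p7 : (x : ℕ → ℕ) → (∀ i → x i ≢ 0) → StrictlyIncreasing x →
    (T : Seq → Set) → IsTree T → XSqueezed x T →
    (n : ℕ) → LevelFinite T n
lemma7p7 x _ inc T _ squeezed n with squeezed n
... | k , j , m , boundSystem , η , squeezedBy =
  levelFinite-byPrefixes T n (etaList k m η)
    (squeezed-coversLevel T n k j m η squeezedBy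
      (boundSystem-above x inc n k j m boundSystem))
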